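{- Let $\varphi(k)=\frac{27k}{2k+27}$ for rational $k>0$ and $\psi(k)=\frac{27k}{|2k-27|}$ for rational $k>0$, $k\neq\frac{27}{2}$. Let $\Gamma$ be the graph whose vertex set is $\mathbb{Q}_{>0}$, in which each $k$ is joined by an edge to $\varphi(k)$ and, if $k\neq\frac{27}{2}$, to $\psi(k)$. Then the connected components of $\Gamma$ (superclasses) are exactly the following sets: (a) for each rational $k>27$, the set $\{k,\psi(k),\varphi(k),\varphi(\psi(k)),\varphi(\varphi(k)),\varphi(\varphi(\psi(k))),\varphi^3(k),\ldots\}=\{\varphi^n(k):n\ge0\}\cup\{\varphi^n(\psi(k)):n\ge0\}$, which contains exactly one number greater than $27$, namely $k$; (b) the set generated by $27$, namely $\{27,9,\frac{27}{5},\frac{27}{7},\ldots\}=\{\frac{27}{2n+1}:n\ge0\}$; (c) the set generated by $\frac{27}{2}$, namely $\{\frac{27}{2},\frac{27}{4},\frac{27}{6},\ldots\}=\{\frac{27}{2n}:n\ge1\}$.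
   Context: Background: for a cubic Galois polynomial (irreducible cubic over $\mathbb{Q}$ with cyclic Galois group $A_3$), its class of linear equivalency (polynomials obtained by a rational linear change of variable, up to a nonzero constant factor) contains a unique polynomial $x^3-ax-a$, and the rational $k>0$ with $4a-27=k^2$ is the class's characteristic number. Two classes are adjacent if they contain coupled polynomials (polynomials whose roots are cyclically permuted by a common quadratic $q\in\mathbb{Q}[x]$); the classes adjacent to a class with characteristic number $k$ have characteristic numbers $\varphi(k)$ and $\psi(k)$. Superclasses are connected components of the adjacency graph of classes; following the paper, a superclass is described as a set of characteristic numbers, i.e. as a connected component of the graph $\Gamma$ on characteristic numbers defined in the claim (some characteristic numbers in such a set may correspond to classes of reducible polynomials). -}

module Defs where

open import Data.Nat as ℕ using (ℕ; zero; suc)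
open import Data.Integer using (+_)
open import Data.Rational using (ℚ; 0ℚ; _+_; _*_; _-_; _/_; ∣_∣; 1/_; ≢-nonZero; _<_)
open import Data.Rational.Properties using (_≟_)
open import Data.Product using (_×_; ∃)
open import Data.Sum using (_⊎_)
open import Relation.Nullary using (¬_; yes; no)
open import Relation.Binary.PropositionalEquality using (_≡_)
open import Relation.Binary.Construct.Closure.Equivalence using (EqClosure)

q27 : ℚ
q27 = + 27 / 1

q2 : ℚ
q2 = + 2 / 1

q27/2 : ℚ
q27/2 = + 27 / 2

-- Totalised division: x ÷' 0 = 0 (junk value, never used on the graph,
-- since φ and ψ below are only used where the denominator is nonzero).
_÷'_ : ℚ → ℚ → ℚ
p ÷' q with q ≟ 0ℚ
... | yes _   = 0ℚ
... | no q≢0 = p * 1/_ q {{≢-nonZero q≢0}}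

φ : ℚ → ℚ
φ k = (q27 * k) ÷' (q2 * k + q27)

ψ : ℚ → ℚ
ψ k = (q27 * k) ÷' ∣ q2 * k - q27 ∣

iter : {A : Set} → ℕ → (A → A) → A → A
iter zero    f x = x
iter (suc n) f x = f (iter n f x)

data Edge : ℚ → ℚ → Set where
  edgeφ : ∀ {k} → 0ℚ < k → Edge k (φ k)
  edgeψ : ∀ {k} → 0ℚ < k → ¬ (k ≡ q27/2) → Edge k (ψ k)

Connected : ℚ → ℚ → Set
Connected = EqClosure Edge

SuperA : ℚ → ℚ → Set
SuperA k x = (∃ λ n → x ≡ iter n φ k) ⊎ (∃ λ n → x ≡ iter n φ (ψ k))

SuperB : ℚ → Set
SuperB x = ∃ λ (n : ℕ) → x ≡ (+ 27 / suc (2 ℕ.* n))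

-- {27/(2n) : n ≥ 1}  (written with m = n - 1 ≥ 0)
SuperC : ℚ → Set
SuperC x = ∃ λ (m : ℕ) → x ≡ (+ 27 / (2 ℕ.* suc m))

{-# OPTIONS --safe #-}
module Submission where

-- The involution τ x = 27/x of ℚ>0 conjugates φ to u ↦ u + 2 and ψ to
-- u ↦ |u − 2|.  For 0 ≤ r ≤ 2 the set (r + 2ℕ) ∪ (2 − r + 2ℕ) is closed under
-- these moves and their inverses, and its positive elements are reached from
-- r by φ-steps and at most one ψ-step; so in τ-coordinates it is the component
-- of r.  Every u > 0 lies in such a set with r ∈ (0, 1) ∪ {1, 2}, and τ maps
-- these back to the components of k = τ r > 27, of 27 = τ 1 and of 27/2 = τ 2.

open import Defs
open import Data.Nat as ℕ using (ℕ; zero; suc; s≤s; z≤n)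
import Data.Nat.Properties as ℕP
open import Data.Integer as ℤ using (+_; -[1+_])
import Data.Integer.Properties as ℤP
open import Data.Rational
open import Data.Rational.Properties
import Data.Rational.Unnormalised as ℚᵘ
import Data.Rational.Unnormalised.Properties as ℚᵘP
open import Data.Rational.Solver using (module +-*-Solver)
open +-*-Solver using (solve; _:=_; _:+_; _:*_; _:-_; :-_)
open import Data.Product using (_×_; ∃; _,_)
open import Data.Sum as Sum using (_⊎_; inj₁; inj₂)
open import Function.Base using (_∘_; id)
open import Function.Bundles using (_⇔_; mk⇔; Equivalence)
open import Function.Properties.Equivalence using (⇔-isEquivalence) renaming (sym to ⇔-sym)
open import Relation.Nullary using (¬_; contradiction)
open import Relation.Nullary.Decidable using (yes; no; toWitness)
open import Relation.Binary.Definitions using (tri<; tri≈; tri>)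
open import Relation.Binary.PropositionalEquality
open import Relation.Binary.Construct.Closure.ReflexiveTransitive using (ε; _◅◅_)
open import Relation.Binary.Construct.Closure.Equivalence using (gfold; return)

0<2 : 0ℚ < q2
0<2 = positive⁻¹ q2

0<27 : 0ℚ < q27
0<27 = positive⁻¹ q27

0<27/2 : 0ℚ < q27/2
0<27/2 = positive⁻¹ q27/2

1<2 : 1ℚ < q2
1<2 = toWitness {a? = 1ℚ <? q2} _

27/2<27 : q27/2 < q27
27/2<27 = toWitness {a? = q27/2 <? q27} _

0<⇒≢0 : ∀ {p} → 0ℚ < p → p ≢ 0ℚ
0<⇒≢0 0<p = ≢-sym (<⇒≢ 0<p)

<⇒≱ : ∀ {p q} → p < q → ¬ (q ≤ p)
<⇒≱ p<q q≤p = <-irrefl refl (<-≤-trans p<q q≤p)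

≤∧≢⇒< : ∀ {p q} → p ≤ q → p ≢ q → p < q
≤∧≢⇒< p≤q p≢q = ≰⇒> (λ q≤p → p≢q (≤-antisym p≤q q≤p))

*-pos : ∀ {p q} → 0ℚ < p → 0ℚ < q → 0ℚ < p * q
*-pos {p} {q} 0<p 0<q = positive⁻¹ _ {{pos*pos⇒pos p {{positive 0<p}} q {{positive 0<q}}}}

p<q⇒0<q-p : ∀ {p q} → p < q → 0ℚ < q - p
p<q⇒0<q-p {p} {q} p<q = subst (_< q - p) (+-inverseʳ p) (+-monoˡ-< (- p) p<q)

p≤q⇒0≤q-p : ∀ {p q} → p ≤ q → 0ℚ ≤ q - p
p≤q⇒0≤q-p {p} {q} p≤q = subst (_≤ q - p) (+-inverseʳ p) (+-monoˡ-≤ (- p) p≤q)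

r-q<r-p : ∀ r {p q} → p < q → r - q < r - p
r-q<r-p r p<q = +-monoʳ-< r (neg-antimono-< p<q)

r-q≤r-p : ∀ r {p q} → p ≤ q → r - q ≤ r - p
r-q≤r-p r p≤q = +-monoʳ-≤ r (neg-antimono-≤ p≤q)

p+q-q≡p : ∀ p q → p + q - q ≡ p
p+q-q≡p = solve 2 (λ p q → p :+ q :- q := p) refl

p-q+q≡p : ∀ p q → p - q + q ≡ p
p-q+q≡p = solve 2 (λ p q → p :- q :+ q := p) refl

p-[p-q]≡q : ∀ p q → p - (p - q) ≡ q
p-[p-q]≡q = solve 2 (λ p q → p :- (p :- q) := q) refl

∣p-q∣≡q-p : ∀ {p q} → p ≤ q → ∣ p - q ∣ ≡ q - p
∣p-q∣≡q-p {p} {q} p≤q = begin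
  ∣ p - q ∣       ≡⟨ cong ∣_∣ (solve 2 (λ p q → p :- q := :- (q :- p)) refl p q) ⟩
  ∣ - (q - p) ∣   ≡⟨ ∣-p∣≡∣p∣ (q - p) ⟩
  ∣ q - p ∣       ≡⟨ 0≤p⇒∣p∣≡p (p≤q⇒0≤q-p p≤q) ⟩
  q - p           ∎
  where open ≡-Reasoning

÷'-*-cancel : ∀ a {b} → b ≢ 0ℚ → (a ÷' b) * b ≡ a
÷'-*-cancel a {b} b≢0 with b ≟ 0ℚ
... | yes b≡0 = contradiction b≡0 b≢0
... | no b≢0′ =
  trans (*-assoc a _ b) (trans (cong (a *_) (*-inverseˡ b {{≢-nonZero b≢0′}})) (*-identityʳ a))

÷'-unique : ∀ {a b c} → b ≢ 0ℚ → c * b ≡ a → a ÷' b ≡ c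
÷'-unique {b = b} {c} b≢0 refl with b ≟ 0ℚ
... | yes b≡0 = contradiction b≡0 b≢0
... | no b≢0′ =
  trans (*-assoc c b _) (trans (cong (c *_) (*-inverseʳ b {{≢-nonZero b≢0′}})) (*-identityʳ c))

÷'-pos : ∀ {a b} → 0ℚ < a → 0ℚ < b → 0ℚ < a ÷' b
÷'-pos {b = b} 0<a 0<b with b ≟ 0ℚ
... | yes b≡0 = contradiction b≡0 (0<⇒≢0 0<b)
... | no _    = *-pos 0<a (positive⁻¹ _ {{1/pos⇒pos b {{positive 0<b}}}})

*-cancelʳ-≢0 : ∀ {p q} r → r ≢ 0ℚ → p * r ≡ q * r → p ≡ q
*-cancelʳ-≢0 r r≢0 eq = trans (sym (÷'-unique r≢0 refl)) (÷'-unique r≢0 (sym eq))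

τ : ℚ → ℚ
τ x = q27 ÷' x

τ-pos : ∀ {x} → 0ℚ < x → 0ℚ < τ x
τ-pos 0<x = ÷'-pos 0<27 0<x

τx*x≡27 : ∀ {x} → 0ℚ < x → τ x * x ≡ q27
τx*x≡27 0<x = ÷'-*-cancel q27 (0<⇒≢0 0<x)

τ-unique : ∀ {x y} → 0ℚ < x → y * x ≡ q27 → τ x ≡ y
τ-unique 0<x = ÷'-unique (0<⇒≢0 0<x)

τ-involutive : ∀ {x} → 0ℚ < x → τ (τ x) ≡ x
τ-involutive {x} 0<x = τ-unique (τ-pos 0<x) (trans (*-comm x (τ x)) (τx*x≡27 0<x))

τ-injective : ∀ {x y} → 0ℚ < x → 0ℚ < y → τ x ≡ τ y → x ≡ y
τ-injective 0<x 0<y τx≡τy =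
  trans (sym (τ-involutive 0<x)) (trans (cong τ τx≡τy) (τ-involutive 0<y))

τ-antimono-< : ∀ {x y} → 0ℚ < x → x < y → τ y < τ x
τ-antimono-< {x} {y} 0<x x<y =
  *-cancelʳ-<-nonNeg (x * y) {{pos⇒nonNeg (x * y) {{positive 0<xy}}}}
    (subst₂ _<_ (27*b≡τa*[b*a] y x 0<y) 27*y≡τx*[x*y] (*-monoʳ-<-pos q27 x<y))
  where
  0<y = <-trans 0<x x<y
  0<xy = *-pos 0<x 0<y
  27*b≡τa*[b*a] : ∀ a b → 0ℚ < a → q27 * b ≡ τ a * (b * a)
  27*b≡τa*[b*a] a b 0<a = begin
    q27 * b          ≡⟨ cong (_* b) (τx*x≡27 0<a) ⟨
    τ a * a * b      ≡⟨ solve 3 (λ t a b → t :* a :* b := t :* (b :* a)) refl (τ a) a b ⟩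
    τ a * (b * a)    ∎
    where open ≡-Reasoning
  27*y≡τx*[x*y] : q27 * y ≡ τ x * (x * y)
  27*y≡τx*[x*y] = trans (27*b≡τa*[b*a] x y 0<x) (cong (τ x *_) (*-comm y x))

-- φ and ψ are both of the form x ↦ 27x / d, which τ turns into d / x.
τ-ratio : ∀ {x d} → 0ℚ < x → 0ℚ < d → τ ((q27 * x) ÷' d) ≡ d ÷' x
τ-ratio {x} {d} 0<x 0<d = τ-unique (÷'-pos (*-pos 0<27 0<x) 0<d) (*-cancelʳ-≢0 d (0<⇒≢0 0<d) (begin
  (d ÷' x) * y * d        ≡⟨ *-assoc (d ÷' x) y d ⟩
  (d ÷' x) * (y * d)      ≡⟨ cong ((d ÷' x) *_) (÷'-*-cancel (q27 * x) (0<⇒≢0 0<d)) ⟩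
  (d ÷' x) * (q27 * x)    ≡⟨ solve 3 (λ a c x → a :* (c :* x) := c :* (a :* x)) refl (d ÷' x) q27 x ⟩
  q27 * ((d ÷' x) * x)    ≡⟨ cong (q27 *_) (÷'-*-cancel d (0<⇒≢0 0<x)) ⟩
  q27 * d                 ∎))
  where
  open ≡-Reasoning
  y = (q27 * x) ÷' d

0<2x+27 : ∀ {x} → 0ℚ < x → 0ℚ < q2 * x + q27
0<2x+27 0<x = +-mono-< (*-pos 0<2 0<x) 0<27

φ-pos : ∀ {x} → 0ℚ < x → 0ℚ < φ x
φ-pos 0<x = ÷'-pos (*-pos 0<27 0<x) (0<2x+27 0<x)

τ-φ : ∀ {x} → 0ℚ < x → τ (φ x) ≡ τ x + q2
τ-φ {x} 0<x = trans (τ-ratio 0<x (0<2x+27 0<x)) (÷'-unique (0<⇒≢0 0<x) (begin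
  (τ x + q2) * x      ≡⟨ solve 3 (λ t c x → (t :+ c) :* x := t :* x :+ c :* x) refl (τ x) q2 x ⟩
  τ x * x + q2 * x    ≡⟨ cong (_+ q2 * x) (τx*x≡27 0<x) ⟩
  q27 + q2 * x        ≡⟨ +-comm q27 (q2 * x) ⟩
  q2 * x + q27        ∎))
  where open ≡-Reasoning

0<∣2x-27∣ : ∀ {x} → x ≢ q27/2 → 0ℚ < ∣ q2 * x - q27 ∣
0<∣2x-27∣ {x} x≢27/2 =
  ≤∧≢⇒< (0≤∣p∣ _) (λ 0≡∣2x-27∣ → x≢27/2 (*-cancelʳ-≢0 q2 (0<⇒≢0 0<2) (begin
  x * q2                ≡⟨ solve 3 (λ x c d → x :* c := (c :* x :- d) :+ d) refl x q2 q27 ⟩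
  (q2 * x - q27) + q27  ≡⟨ cong (_+ q27) (∣p∣≡0⇒p≡0 _ (sym 0≡∣2x-27∣)) ⟩
  0ℚ + q27              ≡⟨⟩
  q27/2 * q2            ∎)))
  where open ≡-Reasoning

ψ-pos : ∀ {x} → 0ℚ < x → x ≢ q27/2 → 0ℚ < ψ x
ψ-pos 0<x x≢27/2 = ÷'-pos (*-pos 0<27 0<x) (0<∣2x-27∣ x≢27/2)

τ-ψ : ∀ {x} → 0ℚ < x → x ≢ q27/2 → τ (ψ x) ≡ ∣ τ x - q2 ∣
τ-ψ {x} 0<x x≢27/2 = trans (τ-ratio 0<x (0<∣2x-27∣ x≢27/2)) (÷'-unique (0<⇒≢0 0<x) (begin
  ∣ τ x - q2 ∣ * x            ≡⟨ cong (∣ τ x - q2 ∣ *_) (0≤p⇒∣p∣≡p (<⇒≤ 0<x)) ⟨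
  ∣ τ x - q2 ∣ * ∣ x ∣        ≡⟨ ∣p*q∣≡∣p∣*∣q∣ (τ x - q2) x ⟨
  ∣ (τ x - q2) * x ∣          ≡⟨ cong ∣_∣ (solve 3 (λ t c x → (t :- c) :* x := t :* x :- c :* x)
                                                    refl (τ x) q2 x) ⟩
  ∣ τ x * x - q2 * x ∣        ≡⟨ cong (λ t → ∣ t - q2 * x ∣) (τx*x≡27 0<x) ⟩
  ∣ q27 - q2 * x ∣            ≡⟨ cong ∣_∣ (solve 2 (λ c x → c :- x := :- (x :- c)) refl q27 (q2 * x)) ⟩
  ∣ - (q2 * x - q27) ∣        ≡⟨ ∣-p∣≡∣p∣ (q2 * x - q27) ⟩
  ∣ q2 * x - q27 ∣            ∎))
  where open ≡-Reasoning

27<⇒τ<1 : ∀ {x} → q27 < x → τ x < 1ℚ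
27<⇒τ<1 27<x = τ-antimono-< 0<27 27<x

τ<1⇒27<τ : ∀ {r} → 0ℚ < r → r < 1ℚ → q27 < τ r
τ<1⇒27<τ 0<r r<1 = τ-antimono-< 0<r r<1

fromℕ : ℕ → ℚ
fromℕ n = + n / 1

toℚᵘ-fromℕ : ∀ n → toℚᵘ (fromℕ n) ℚᵘ.≃ ℚᵘ.mkℚᵘ (+ n) 0
toℚᵘ-fromℕ n = toℚᵘ-fromℚᵘ (ℚᵘ.mkℚᵘ (+ n) 0)

fromℕ-+ : ∀ m n → fromℕ (m ℕ.+ n) ≡ fromℕ m + fromℕ n
fromℕ-+ m n = toℚᵘ-injective (begin
  toℚᵘ (fromℕ (m ℕ.+ n))                   ≈⟨ toℚᵘ-fromℕ (m ℕ.+ n) ⟩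
  ℚᵘ.mkℚᵘ (+ (m ℕ.+ n)) 0                  ≈⟨ ℚᵘ.*≡* (cong (ℤ._* + 1) numerators) ⟩
  ℚᵘ.mkℚᵘ (+ m) 0 ℚᵘ.+ ℚᵘ.mkℚᵘ (+ n) 0     ≈⟨ ℚᵘP.+-cong (toℚᵘ-fromℕ m) (toℚᵘ-fromℕ n) ⟨
  toℚᵘ (fromℕ m) ℚᵘ.+ toℚᵘ (fromℕ n)       ≈⟨ toℚᵘ-homo-+ (fromℕ m) (fromℕ n) ⟨
  toℚᵘ (fromℕ m + fromℕ n)                 ∎)
  where
  open ℚᵘP.≃-Reasoning
  numerators : + (m ℕ.+ n) ≡ + m ℤ.* + 1 ℤ.+ + n ℤ.* + 1
  numerators = trans (ℤP.pos-+ m n) (sym (cong₂ ℤ._+_ (ℤP.*-identityʳ (+ m)) (ℤP.*-identityʳ (+ n))))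

fromℕ-*-/ : ∀ i d .{{_ : ℕ.NonZero d}} → fromℕ d * (+ i / d) ≡ fromℕ i
fromℕ-*-/ i (suc d) = toℚᵘ-injective (begin
  toℚᵘ (fromℕ (suc d) * (+ i / suc d))               ≈⟨ toℚᵘ-homo-* (fromℕ (suc d)) (+ i / suc d) ⟩
  toℚᵘ (fromℕ (suc d)) ℚᵘ.* toℚᵘ (+ i / suc d)       ≈⟨ ℚᵘP.*-cong (toℚᵘ-fromℕ (suc d))
                                                                      (toℚᵘ-fromℚᵘ (ℚᵘ.mkℚᵘ (+ i) d)) ⟩
  ℚᵘ.mkℚᵘ (+ suc d) 0 ℚᵘ.* ℚᵘ.mkℚᵘ (+ i) d           ≈⟨ ℚᵘ.*≡* cross ⟩
  ℚᵘ.mkℚᵘ (+ i) 0                                    ≈⟨ toℚᵘ-fromℕ i ⟨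
  toℚᵘ (fromℕ i)                                     ∎)
  where
  open ℚᵘP.≃-Reasoning
  cross : (+ suc d ℤ.* + i) ℤ.* + 1 ≡ + i ℤ.* + suc (d ℕ.+ 0)
  cross = trans (ℤP.*-identityʳ _)
         (trans (ℤP.*-comm (+ suc d) (+ i)) (cong (λ n → + i ℤ.* + suc n) (sym (ℕP.+-identityʳ d))))

0<27/d : ∀ d .{{_ : ℕ.NonZero d}} → 0ℚ < + 27 / d
0<27/d d = positive⁻¹ (+ 27 / d) {{normalize-pos 27 d}}

τ-27/d : ∀ d .{{_ : ℕ.NonZero d}} → τ (+ 27 / d) ≡ fromℕ d
τ-27/d d = τ-unique (0<27/d d) (fromℕ-*-/ 27 d)

even : ℕ → ℚ
even zero    = 0ℚ
even (suc n) = even n + q2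

even-nonNeg : ∀ n → 0ℚ ≤ even n
even-nonNeg zero    = ≤-refl
even-nonNeg (suc n) = +-mono-≤ (even-nonNeg n) (<⇒≤ 0<2)

even≡fromℕ : ∀ n → even n ≡ fromℕ (2 ℕ.* n)
even≡fromℕ zero    = refl
even≡fromℕ (suc n) = begin
  even n + q2                   ≡⟨ cong (_+ q2) (even≡fromℕ n) ⟩
  fromℕ (2 ℕ.* n) + fromℕ 2     ≡⟨ fromℕ-+ (2 ℕ.* n) 2 ⟨
  fromℕ (2 ℕ.* n ℕ.+ 2)         ≡⟨ cong fromℕ (trans (ℕP.+-comm (2 ℕ.* n) 2) (sym (ℕP.*-suc 2 n))) ⟩
  fromℕ (2 ℕ.* suc n)           ∎
  where open ≡-Reasoning

fromℕ-+-even : ∀ a n → fromℕ (a ℕ.+ 2 ℕ.* n) ≡ fromℕ a + even n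
fromℕ-+-even a n = trans (fromℕ-+ a (2 ℕ.* n)) (cong (λ e → fromℕ a + e) (sym (even≡fromℕ n)))

τ-27/odd : ∀ n → τ (+ 27 / suc (2 ℕ.* n)) ≡ 1ℚ + even n
τ-27/odd n = trans (τ-27/d (suc (2 ℕ.* n))) (fromℕ-+-even 1 n)

τ-27/even : ∀ n → τ (+ 27 / (2 ℕ.* suc n)) ≡ q2 + even n
τ-27/even n = trans (τ-27/d (2 ℕ.* suc n)) (trans (cong fromℕ (ℕP.*-suc 2 n)) (fromℕ-+-even 2 n))

archimedean : ∀ {u} → 0ℚ < u → ∃ λ N → u < even N
archimedean {mkℚ (+ zero) _ _} 0<u with positive 0<u
... | ()
archimedean {mkℚ -[1+ _ ] _ _} 0<u with positive 0<u
... | ()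
archimedean {u@(mkℚ (+ suc a) b _)} _ =
  suc a , subst (u <_) (sym (even≡fromℕ (suc a)))
    (toℚᵘ-cancel-< (ℚᵘP.<-respʳ-≃ (ℚᵘP.≃-sym (toℚᵘ-fromℕ (2 ℕ.* suc a))) (ℚᵘ.*<* cross)))
  where
  a<2a*b : suc a ℕ.< 2 ℕ.* suc a ℕ.* suc b
  a<2a*b = ℕP.<-≤-trans (ℕP.m<m+n (suc a) (s≤s z≤n)) (ℕP.m≤m*n (2 ℕ.* suc a) (suc b))
  cross : + suc a ℤ.* + 1 ℤ.< + (2 ℕ.* suc a) ℤ.* + suc b
  cross = subst₂ ℤ._<_ (sym (ℤP.*-identityʳ (+ suc a))) (ℤP.pos-* (2 ℕ.* suc a) (suc b)) (ℤ.+<+ a<2a*b)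

AP : ℚ → ℚ → Set
AP a u = ∃ λ n → u ≡ a + even n

Orbit : ℚ → ℚ → Set
Orbit r u = AP r u ⊎ AP (q2 - r) u

≡⇒AP : ∀ {a u} → u ≡ a → AP a u
≡⇒AP {a} u≡a = 0 , trans u≡a (sym (+-identityʳ a))

AP-refl : ∀ a → AP a a
AP-refl a = ≡⇒AP refl

AP⇒≤ : ∀ {a u} → AP a u → a ≤ u
AP⇒≤ {a} (n , refl) = subst (_≤ a + even n) (+-identityʳ a) (+-monoʳ-≤ a (even-nonNeg n))

AP-shift⁺ : ∀ {a u} → AP a u → AP a (u + q2)
AP-shift⁺ {a} (n , refl) = suc n , +-assoc a (even n) q2

AP-shift⁻ : ∀ {a u} → a ≤ q2 → 0ℚ < u → AP a (u + q2) → AP a u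
AP-shift⁻ {a} a≤2 0<u (zero , u+2≡a+0) =
  contradiction (≤-trans (≤-reflexive (trans u+2≡a+0 (+-identityʳ a))) a≤2) (<⇒≱ (+-monoˡ-< q2 0<u))
AP-shift⁻ {a} {u} _ _ (suc n , u+2≡a+2n+2) = n , (begin
  u                          ≡⟨ p+q-q≡p u q2 ⟨
  u + q2 - q2                ≡⟨ cong (_- q2) u+2≡a+2n+2 ⟩
  a + (even n + q2) - q2     ≡⟨ cong (_- q2) (+-assoc a (even n) q2) ⟨
  a + even n + q2 - q2       ≡⟨ p+q-q≡p (a + even n) q2 ⟩
  a + even n                 ∎)
  where open ≡-Reasoning

AP-below-2 : ∀ {a u} → 0ℚ ≤ a → u < q2 → AP a u → u ≡ a
AP-below-2 {a} _ _ (zero , u≡a+0) = trans u≡a+0 (+-identityʳ a)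
AP-below-2 {a} 0≤a u<2 (suc n , refl) = contradiction 2≤a+2n+2 (<⇒≱ u<2)
  where
  2≤a+2n+2 : q2 ≤ a + (even n + q2)
  2≤a+2n+2 = subst (q2 ≤_) (+-assoc a (even n) q2) (+-monoˡ-≤ q2 (≤-trans 0≤a (AP⇒≤ (n , refl))))

AP0⇒AP2 : ∀ {u} → 0ℚ < u → AP 0ℚ u → AP q2 u
AP0⇒AP2 0<u (zero , u≡0) = contradiction u≡0 (0<⇒≢0 0<u)
AP0⇒AP2 _ (suc n , refl) = n , trans (+-identityˡ _) (+-comm (even n) q2)

AP-reduce : ∀ N {u} → 0ℚ < u → u < even N → ∃ λ r → 0ℚ < r × r ≤ q2 × AP r u
AP-reduce zero 0<u u<0 = contradiction u<0 (<-asym 0<u)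
AP-reduce (suc N) {u} 0<u u<2N+2 with u ≤? q2
... | yes u≤2 = u , 0<u , u≤2 , AP-refl u
... | no u≰2 =
  let r , 0<r , r≤2 , ap = AP-reduce N (p<q⇒0<q-p (≰⇒> u≰2)) u-2<2N
  in  r , 0<r , r≤2 , subst (AP r) (p-q+q≡p u q2) (AP-shift⁺ {r} ap)
  where
  u-2<2N : u - q2 < even N
  u-2<2N = subst (u - q2 <_) (p+q-q≡p (even N) q2) (+-monoˡ-< (- q2) u<2N+2)

AP-representative : ∀ {u} → 0ℚ < u → ∃ λ r → 0ℚ < r × r ≤ q2 × AP r u
AP-representative 0<u with archimedean 0<u
... | N , u<2N = AP-reduce N 0<u u<2N

Orbit-normalise : ∀ {r u} → 0ℚ < r → r ≤ q2 → AP r u →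
                  (∃ λ s → 0ℚ < s × s < 1ℚ × Orbit s u) ⊎ AP 1ℚ u ⊎ AP q2 u
Orbit-normalise {r} 0<r r≤2 ap with <-cmp r 1ℚ
... | tri< r<1 _ _ = inj₁ (r , 0<r , r<1 , inj₁ ap)
... | tri≈ _ refl _ = inj₂ (inj₁ ap)
... | tri> _ _ 1<r with <-cmp r q2
...   | tri< r<2 _ _ = inj₁ (q2 - r , p<q⇒0<q-p r<2 , r-q<r-p q2 1<r ,
                             inj₂ (subst (λ a → AP a _) (sym (p-[p-q]≡q q2 r)) ap))
...   | tri≈ _ refl _ = inj₂ (inj₂ ap)
...   | tri> _ _ 2<r = contradiction r≤2 (<⇒≱ 2<r)

module _ {r : ℚ} (0≤r : 0ℚ ≤ r) (r≤2 : r ≤ q2) where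

  Orbit-shift : ∀ {u} → 0ℚ < u → Orbit r u ⇔ Orbit r (u + q2)
  Orbit-shift 0<u = mk⇔ (Sum.map (AP-shift⁺ {r}) (AP-shift⁺ {q2 - r}))
                         (Sum.map (AP-shift⁻ {r} r≤2 0<u) (AP-shift⁻ {q2 - r} (r-q≤r-p q2 0≤r) 0<u))

  Orbit-reflect : ∀ {u} → u < q2 → Orbit r u → Orbit r (q2 - u)
  Orbit-reflect u<2 (inj₁ ap) = inj₂ (≡⇒AP (cong (λ v → q2 - v) (AP-below-2 0≤r u<2 ap)))
  Orbit-reflect u<2 (inj₂ ap) =
    inj₁ (≡⇒AP (trans (cong (λ v → q2 - v) (AP-below-2 (p≤q⇒0≤q-p r≤2) u<2 ap)) (p-[p-q]≡q q2 r)))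

  Orbit-∣-2∣ : ∀ {u} → 0ℚ < u → u ≢ q2 → Orbit r u ⇔ Orbit r ∣ u - q2 ∣
  Orbit-∣-2∣ {u} 0<u u≢2 with <-cmp u q2
  ... | tri< u<2 _ _ = subst (λ v → Orbit r u ⇔ Orbit r v) (sym (∣p-q∣≡q-p (<⇒≤ u<2)))
    (mk⇔ (Orbit-reflect u<2) (subst (Orbit r) (p-[p-q]≡q q2 u) ∘ Orbit-reflect (r-q<r-p q2 0<u)))
  ... | tri≈ _ u≡2 _ = contradiction u≡2 u≢2
  ... | tri> _ _ 2<u = subst (λ v → Orbit r u ⇔ Orbit r v) (sym (0≤p⇒∣p∣≡p (p≤q⇒0≤q-p (<⇒≤ 2<u))))
    (⇔-sym (subst (λ v → Orbit r (u - q2) ⇔ Orbit r v) (p-q+q≡p u q2) (Orbit-shift (p<q⇒0<q-p 2<u))))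

  Edge⇒Orbit⇔ : ∀ {a b} → Edge a b → Orbit r (τ a) ⇔ Orbit r (τ b)
  Edge⇒Orbit⇔ {a} (edgeφ 0<a) =
    subst (λ v → Orbit r (τ a) ⇔ Orbit r v) (sym (τ-φ 0<a)) (Orbit-shift (τ-pos 0<a))
  Edge⇒Orbit⇔ {a} (edgeψ 0<a a≢27/2) =
    subst (λ v → Orbit r (τ a) ⇔ Orbit r v) (sym (τ-ψ 0<a a≢27/2))
      (Orbit-∣-2∣ (τ-pos 0<a) (λ τa≡2 → a≢27/2 (trans (sym (τ-involutive 0<a)) (cong τ τa≡2))))

  Connected⇒Orbit⇔ : ∀ {a b} → Connected a b → Orbit r (τ a) ⇔ Orbit r (τ b)
  Connected⇒Orbit⇔ = gfold ⇔-isEquivalence (Orbit r ∘ τ) Edge⇒Orbit⇔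

Connected⇒Orbit-τ : ∀ {k x} → 0ℚ < k → τ k ≤ q2 → Connected k x → Orbit (τ k) (τ x)
Connected⇒Orbit-τ {k} 0<k τk≤2 k~x =
  Equivalence.to (Connected⇒Orbit⇔ (<⇒≤ (τ-pos 0<k)) τk≤2 k~x) (inj₁ (AP-refl (τ k)))

iter-φ-pos : ∀ {k} → 0ℚ < k → ∀ n → 0ℚ < iter n φ k
iter-φ-pos 0<k zero    = 0<k
iter-φ-pos 0<k (suc n) = φ-pos (iter-φ-pos 0<k n)

τ-iter-φ : ∀ {k} → 0ℚ < k → ∀ n → τ (iter n φ k) ≡ τ k + even n
τ-iter-φ {k} 0<k zero    = sym (+-identityʳ (τ k))
τ-iter-φ {k} 0<k (suc n) = begin
  τ (φ (iter n φ k))        ≡⟨ τ-φ (iter-φ-pos 0<k n) ⟩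
  τ (iter n φ k) + q2       ≡⟨ cong (_+ q2) (τ-iter-φ 0<k n) ⟩
  τ k + even n + q2         ≡⟨ +-assoc (τ k) (even n) q2 ⟩
  τ k + even (suc n)        ∎
  where open ≡-Reasoning

Connected-iter-φ : ∀ {k} → 0ℚ < k → ∀ n → Connected k (iter n φ k)
Connected-iter-φ 0<k zero    = ε
Connected-iter-φ 0<k (suc n) = Connected-iter-φ 0<k n ◅◅ return (edgeφ (iter-φ-pos 0<k n))

AP-τ⇒iter-φ : ∀ {k x} → 0ℚ < k → 0ℚ < x → AP (τ k) (τ x) → ∃ λ n → x ≡ iter n φ k
AP-τ⇒iter-φ 0<k 0<x (n , τx≡τk+2n) =
  n , τ-injective 0<x (iter-φ-pos 0<k n) (trans τx≡τk+2n (sym (τ-iter-φ 0<k n)))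

AP-τ⇒Connected : ∀ {k x} → 0ℚ < k → 0ℚ < x → AP (τ k) (τ x) → Connected k x
AP-τ⇒Connected 0<k 0<x ap with AP-τ⇒iter-φ 0<k 0<x ap
... | n , refl = Connected-iter-φ 0<k n

module _ {k : ℚ} (27<k : q27 < k) where

  private
    0<k : 0ℚ < k
    0<k = <-trans 0<27 27<k

    k≢27/2 : k ≢ q27/2
    k≢27/2 k≡27/2 = <-asym 27<k (subst (_< q27) (sym k≡27/2) 27/2<27)

    τk<2 : τ k < q2
    τk<2 = <-trans (27<⇒τ<1 27<k) 1<2

    τ-ψk : τ (ψ k) ≡ q2 - τ k
    τ-ψk = trans (τ-ψ 0<k k≢27/2) (∣p-q∣≡q-p (<⇒≤ τk<2))

  SuperA⇒Connected : ∀ {x} → SuperA k x → Connected k x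
  SuperA⇒Connected (inj₁ (n , refl)) = Connected-iter-φ 0<k n
  SuperA⇒Connected (inj₂ (n , refl)) =
    return (edgeψ 0<k k≢27/2) ◅◅ Connected-iter-φ (ψ-pos 0<k k≢27/2) n

  Orbit-τ⇒SuperA : ∀ {x} → 0ℚ < x → Orbit (τ k) (τ x) → SuperA k x
  Orbit-τ⇒SuperA 0<x (inj₁ ap) = inj₁ (AP-τ⇒iter-φ 0<k 0<x ap)
  Orbit-τ⇒SuperA 0<x (inj₂ ap) =
    inj₂ (AP-τ⇒iter-φ (ψ-pos 0<k k≢27/2) 0<x (subst (λ a → AP a _) (sym τ-ψk) ap))

  Orbit-τ⇒Connected : ∀ {x} → 0ℚ < x → Orbit (τ k) (τ x) → Connected k x
  Orbit-τ⇒Connected 0<x = SuperA⇒Connected ∘ Orbit-τ⇒SuperA 0<x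

  Connected⇒SuperA : ∀ {x} → 0ℚ < x → Connected k x → SuperA k x
  Connected⇒SuperA 0<x = Orbit-τ⇒SuperA 0<x ∘ Connected⇒Orbit-τ 0<k (<⇒≤ τk<2)

  SuperA-unique : ∀ {x} → SuperA k x → q27 < x → x ≡ k
  SuperA-unique (inj₁ (n , refl)) 27<x =
    τ-injective (<-trans 0<27 27<x) 0<k
      (AP-below-2 (<⇒≤ (τ-pos 0<k)) (<-trans (27<⇒τ<1 27<x) 1<2) (n , τ-iter-φ 0<k n))
  SuperA-unique (inj₂ (n , refl)) 27<x = contradiction (27<⇒τ<1 27<x) (<-asym 1<τx)
    where
    τx≡2-τk : τ (iter n φ (ψ k)) ≡ q2 - τ k
    τx≡2-τk = AP-below-2 (p≤q⇒0≤q-p (<⇒≤ τk<2)) (<-trans (27<⇒τ<1 27<x) 1<2)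
                (n , trans (τ-iter-φ (ψ-pos 0<k k≢27/2) n) (cong (_+ even n) τ-ψk))
    1<τx : 1ℚ < τ (iter n φ (ψ k))
    1<τx = subst (1ℚ <_) (sym τx≡2-τk) (r-q<r-p q2 (27<⇒τ<1 27<k))

SuperB⇔AP-τ : ∀ {x} → 0ℚ < x → SuperB x ⇔ AP 1ℚ (τ x)
SuperB⇔AP-τ 0<x = mk⇔
  (λ { (n , refl) → n , τ-27/odd n })
  (λ { (n , τx≡1+2n) → n , τ-injective 0<x (0<27/d (suc (2 ℕ.* n))) (trans τx≡1+2n (sym (τ-27/odd n))) })

SuperC⇔AP-τ : ∀ {x} → 0ℚ < x → SuperC x ⇔ AP q2 (τ x)
SuperC⇔AP-τ 0<x = mk⇔
  (λ { (n , refl) → n , τ-27/even n })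
  (λ { (n , τx≡2+2n) → n , τ-injective 0<x (0<27/d (2 ℕ.* suc n)) (trans τx≡2+2n (sym (τ-27/even n))) })

Connected-27⇔SuperB : ∀ x → 0ℚ < x → Connected q27 x ⇔ SuperB x
Connected-27⇔SuperB x 0<x = mk⇔
  (Equivalence.from (SuperB⇔AP-τ 0<x) ∘ Sum.reduce ∘ Connected⇒Orbit-τ 0<27 (<⇒≤ 1<2))
  (AP-τ⇒Connected 0<27 0<x ∘ Equivalence.to (SuperB⇔AP-τ 0<x))

Connected-27/2⇔SuperC : ∀ x → 0ℚ < x → Connected q27/2 x ⇔ SuperC x
Connected-27/2⇔SuperC x 0<x = mk⇔
  (Equivalence.from (SuperC⇔AP-τ 0<x) ∘ Sum.[ id , AP0⇒AP2 (τ-pos 0<x) ]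
                                       ∘ Connected⇒Orbit-τ 0<27/2 ≤-refl)
  (AP-τ⇒Connected 0<27/2 0<x ∘ Equivalence.to (SuperC⇔AP-τ 0<x))

Connected-representative : ∀ x → 0ℚ < x →
  (∃ λ k → q27 < k × Connected k x) ⊎ Connected q27 x ⊎ Connected q27/2 x
Connected-representative x 0<x with AP-representative (τ-pos 0<x)
... | r , 0<r , r≤2 , ap with Orbit-normalise 0<r r≤2 ap
...   | inj₁ (s , 0<s , s<1 , orbit) = inj₁ (τ s , 27<τs , Orbit-τ⇒Connected 27<τs 0<x orbit′)
  where
  27<τs = τ<1⇒27<τ 0<s s<1
  orbit′ = subst (λ a → Orbit a (τ x)) (sym (τ-involutive 0<s)) orbit
...   | inj₂ (inj₁ ap₁) = inj₂ (inj₁ (AP-τ⇒Connected 0<27 0<x ap₁))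
...   | inj₂ (inj₂ ap₂) = inj₂ (inj₂ (AP-τ⇒Connected 0<27/2 0<x ap₂))

proposition6 :
    ((k : ℚ) → q27 < k →
      ((x : ℚ) → 0ℚ < x → (Connected k x ⇔ SuperA k x))
      × ((x : ℚ) → SuperA k x → q27 < x → x ≡ k))
    × ((x : ℚ) → 0ℚ < x → (Connected q27 x ⇔ SuperB x))
    × ((x : ℚ) → 0ℚ < x → (Connected q27/2 x ⇔ SuperC x))
    × ((x : ℚ) → 0ℚ < x →
        (∃ λ k → q27 < k × Connected k x) ⊎ Connected q27 x ⊎ Connected q27/2 x)
proposition6 =
    (λ k 27<k → (λ x 0<x → mk⇔ (Connected⇒SuperA 27<k 0<x) (SuperA⇒Connected 27<k))
              , (λ x → SuperA-unique 27<k))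
  , Connected-27⇔SuperB
  , Connected-27/2⇔SuperC
  , Connected-representative
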